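{- Let $I$ be an instance of the splittable setup model, $\varepsilon\in(0,1)$ and $T>0$ with $s_j\le T$ for all jobs $j$. Let $\mathcal{J}^{\mathrm{sst}}$ be the set of jobs with $s_j<\varepsilon T$, let $L=\sum_{j\in\mathcal{J}^{\mathrm{sst}}}(s_j+p_j)$, and let $I_1$ be obtained from $I$ by removing the jobs in $\mathcal{J}^{\mathrm{sst}}$. Then a schedule with makespan $T$ for $I$ induces a $(T,L)$-schedule for $I_1$; and for every $T'>0$, any $(T',L)$-schedule for $I_1$ can be transformed into a schedule for $I$ with makespan at most $T'+\varepsilon T$.
   Context: Splittable setup model: jobs $\mathcal{J}$ with processing times $p_j>0$ and setup times $s_j>0$, $m$ identical machines. A schedule splits each job $j$ into finitely many parts with fractions $\lambda_j(1),\dots,\lambda_j(\kappa(j))\in(0,1]$ summing to $1$, and assigns each part to a machine; a part $(j,k)$ contributes $s_j+\lambda_j(k)p_j$ to the load of its machine. The makespan is the maximum load. A $(T',L')$-schedule is a schedule with makespan at most $T'$ whose free space $\sum_{i\in[m]}(T'-\text{load}_i)$ is at least $L'$.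
   Formalization: The processing times $p_j$, the setup times $s_j$, the parameters ε, T and T', and the fractions of the job parts all take values in the rationals. -}

module Defs where

open import Data.Nat using (ℕ)
open import Data.Fin using (Fin) renaming (_≟_ to _≟ᶠ_)
open import Data.Rational using (ℚ; 0ℚ; 1ℚ; _+_; _*_; _-_; _≤_; _<_)
open import Data.Rational.Properties using (_<?_)
open import Data.List using (List; []; _∷_; map; foldr; length; allFin; filter)
open import Data.List.Relation.Unary.All using (All)
open import Data.Product using (_×_; _,_; proj₁; proj₂)
open import Relation.Nullary using (does; ¬?)
open import Data.Bool using (if_then_else_)
open import Relation.Binary.PropositionalEquality using (_≡_)

sumℚ : List ℚ → ℚ
sumℚ = foldr _+_ 0ℚ

record Job : Set where
  constructor job
  field
    p : ℚ
    s : ℚ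
open Job public

PositiveJob : Job → Set
PositiveJob j = (0ℚ < p j) × (0ℚ < s j)

-- A schedule on m machines for the job list js: each job is split into a
-- finite list of parts (machine, fraction).
Schedule : ℕ → List Job → Set
Schedule m js = Fin (length js) → List (Fin m × ℚ)

jobAt : (js : List Job) → Fin (length js) → Job
jobAt (j ∷ js) Fin.zero = j
jobAt (j ∷ js) (Fin.suc k) = jobAt js k

ValidSchedule : ∀ {m} (js : List Job) → Schedule m js → Set
ValidSchedule js σ = ∀ k →
  All (λ part → (0ℚ < proj₂ part) × (proj₂ part ≤ 1ℚ)) (σ k)
  × (sumℚ (map proj₂ (σ k)) ≡ 1ℚ)

partLoad : ∀ {m} → Job → Fin m → Fin m × ℚ → ℚ
partLoad j i (i' , λ') = if does (i' ≟ᶠ i) then s j + λ' * p j else 0ℚ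

load : ∀ {m} (js : List Job) → Schedule m js → Fin m → ℚ
load js σ i = sumℚ (map (λ k → sumℚ (map (partLoad (jobAt js k) i) (σ k)))
                        (allFin (length js)))

MakespanAtMost : ∀ {m} (js : List Job) → Schedule m js → ℚ → Set
MakespanAtMost js σ T = ∀ i → load js σ i ≤ T

freeSpace : ∀ {m} (js : List Job) → Schedule m js → ℚ → ℚ
freeSpace {m} js σ T = sumℚ (map (λ i → T - load js σ i) (allFin m))

IsTLSchedule : ∀ {m} (js : List Job) → Schedule m js → ℚ → ℚ → Set
IsTLSchedule js σ T' L' =
  ValidSchedule js σ × MakespanAtMost js σ T' × (L' ≤ freeSpace js σ T')

smallSetupJobs : ℚ → ℚ → List Job → List Job
smallSetupJobs ε T = filter (λ j → s j <? ε * T)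

removeSmall : ℚ → ℚ → List Job → List Job
removeSmall ε T = filter (λ j → ¬? (s j <? ε * T))

bigL : ℚ → ℚ → List Job → ℚ
bigL ε T js = sumℚ (map (λ j → s j + p j) (smallSetupJobs ε T js))

module Submission where

-- Dropping some jobs from a schedule lowers each load by the load of their parts, and a dropped job j
-- contributes at least s_j + p_j in total, since each of its parts pays the full setup and its
-- fractions sum to 1; so the small-setup jobs leave free space at least L. Conversely, the
-- small-setup jobs are packed greedily into the free space T' - load_i of the machines one after
-- another, wrapping around as in McNaughton's rule. A job that overflows a machine is split and its
-- remainder starts on the next machine with a second setup; that setup is below εT and is charged to
-- an extra allowance of εT on that machine, while all other setups and processing are charged to the
-- free space, whose total L suffices.

open import Defs
open import Algebra.Bundles using (CommutativeMonoid)
open import Data.Bool using (true; false; if_then_else_)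
open import Data.Empty using (⊥-elim)
open import Data.Fin using (Fin; zero; suc) renaming (_≟_ to _≟ᶠ_)
open import Data.List using (List; []; _∷_; map; allFin; tabulate; filter)
open import Data.List.Properties using (map-tabulate; map-cong)
open import Data.List.Relation.Unary.All using (All; []; _∷_)
import Data.List.Relation.Unary.All as All
open import Data.List.Relation.Unary.All.Properties using (filter⁺; all-filter)
open import Data.Nat using (ℕ)
open import Data.Product using (Σ; _×_; _,_; proj₁; proj₂)
open import Data.Rational
  using (ℚ; 0ℚ; 1ℚ; _+_; _*_; _-_; -_; _≤_; _<_; 1/_; NonZero; NonNegative; positive; nonNegative)
open import Data.Rational.Properties as ℚ using (+-*-commutativeRing; _≟_)
open import Data.Vec.Functional as Vector using (head; tail)
open import Function using (_∘_)
open import Level using (0ℓ)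
open import Relation.Binary.PropositionalEquality
open import Relation.Nullary using (does; yes; no)
open import Relation.Nullary.Decidable using (dec⇒maybe)
open import Relation.Unary using (Decidable)
open import Relation.Unary.Properties using (∁?)
open import Algebra.Properties.CommutativeSemigroup
  (CommutativeMonoid.commutativeSemigroup ℚ.+-0-commutativeMonoid)
  using (x∙yz≈y∙xz) renaming (interchange to +-interchange)
import Tactic.RingSolver.Core.AlmostCommutativeRing as ACR
open import Tactic.RingSolver using (solve-∀)

ringℚ : ACR.AlmostCommutativeRing 0ℓ 0ℓ
ringℚ = ACR.fromCommutativeRing +-*-commutativeRing (λ x → dec⇒maybe (0ℚ ≟ x))

0≤+ : ∀ {x y} → 0ℚ ≤ x → 0ℚ ≤ y → 0ℚ ≤ x + y
0≤+ = ℚ.+-mono-≤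

0≤* : ∀ {x y} → 0ℚ ≤ x → 0ℚ ≤ y → 0ℚ ≤ x * y
0≤* {x} {y} 0≤x 0≤y =
  subst (_≤ x * y) (ℚ.*-zeroˡ y) (ℚ.*-monoʳ-≤-nonNeg y {{nonNegative 0≤y}} 0≤x)

p≤q⇒0≤q-p : ∀ {p q} → p ≤ q → 0ℚ ≤ q - p
p≤q⇒0≤q-p {p} {q} p≤q = subst (_≤ q - p) (ℚ.+-inverseʳ p) (ℚ.+-monoˡ-≤ (- p) p≤q)

p<q⇒0<q-p : ∀ {p q} → p < q → 0ℚ < q - p
p<q⇒0<q-p {p} {q} p<q = subst (_< q - p) (ℚ.+-inverseʳ p) (ℚ.+-monoˡ-< (- p) p<q)

[q-p]+p≡q : ∀ p q → (q - p) + p ≡ q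
[q-p]+p≡q = solve-∀ ringℚ

≤-byDifference : ∀ {p q r} → q - p ≡ r → 0ℚ ≤ r → p ≤ q
≤-byDifference {p} {q} refl 0≤q-p =
  subst₂ _≤_ (ℚ.+-identityˡ p) ([q-p]+p≡q p q) (ℚ.+-monoˡ-≤ p 0≤q-p)

<-byDifference : ∀ {p q r} → q - p ≡ r → 0ℚ < r → p < q
<-byDifference {p} {q} refl 0<q-p =
  subst₂ _<_ (ℚ.+-identityˡ p) ([q-p]+p≡q p q) (ℚ.+-monoˡ-< p 0<q-p)

p-q≤p : ∀ {p q} → 0ℚ ≤ q → p - q ≤ p
p-q≤p {p} {q} 0≤q = ≤-byDifference (difference p q) 0≤q
  where
  difference : ∀ p q → p - (p - q) ≡ q
  difference = solve-∀ ringℚ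

p≤q+r⇒p-q≤r : ∀ {p q r} → p ≤ q + r → p - q ≤ r
p≤q+r⇒p-q≤r {p} {q} {r} p≤q+r = ≤-byDifference (difference p q r) (p≤q⇒0≤q-p p≤q+r)
  where
  difference : ∀ p q r → r - (p - q) ≡ (q + r) - p
  difference = solve-∀ ringℚ

p+q≤r⇒q≤r-p : ∀ {p q r} → p + q ≤ r → q ≤ r - p
p+q≤r⇒q≤r-p {p} {q} {r} p+q≤r = ≤-byDifference (difference p q r) (p≤q⇒0≤q-p p+q≤r)
  where
  difference : ∀ p q r → (r - p) - q ≡ r - (p + q)
  difference = solve-∀ ringℚ

p≤p+q : ∀ {p q} → 0ℚ ≤ q → p ≤ p + q
p≤p+q {p} {q} 0≤q = subst (_≤ p + q) (ℚ.+-identityʳ p) (ℚ.+-monoʳ-≤ p 0≤q)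

p≤q+p : ∀ {p q} → 0ℚ ≤ q → p ≤ q + p
p≤q+p {p} {q} 0≤q = subst (_≤ q + p) (ℚ.+-identityˡ p) (ℚ.+-monoˡ-≤ p 0≤q)

fractionOf : ∀ {p x t} → 0ℚ < p → 0ℚ < x → x < t * p →
             Σ ℚ λ u → (0ℚ < u) × (u < t) × (u * p ≡ x)
fractionOf {p} {x} {t} 0<p 0<x x<tp = u , 0<u , u<t , up≡x
  where
  instance
    p≢0 : NonZero p
    p≢0 = ℚ.pos⇒nonZero p {{positive 0<p}}
    p≥0 : NonNegative p
    p≥0 = nonNegative (ℚ.<⇒≤ 0<p)
  u : ℚ
  u = x * 1/ p
  up≡x : u * p ≡ x
  up≡x = begin
    x * 1/ p * p   ≡⟨ ℚ.*-assoc x (1/ p) p ⟩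
    x * (1/ p * p) ≡⟨ cong (x *_) (ℚ.*-inverseˡ p) ⟩
    x * 1ℚ         ≡⟨ ℚ.*-identityʳ x ⟩
    x              ∎
    where open ≡-Reasoning
  0<u : 0ℚ < u
  0<u = ℚ.*-cancelʳ-<-nonNeg p (subst₂ _<_ (sym (ℚ.*-zeroˡ p)) (sym up≡x) 0<x)
  u<t : u < t
  u<t = ℚ.*-cancelʳ-<-nonNeg p (subst (_< t * p) (sym up≡x) x<tp)

module _ {A : Set} where

  sumℚ-map-0 : (xs : List A) → sumℚ (map (λ _ → 0ℚ) xs) ≡ 0ℚ
  sumℚ-map-0 []       = refl
  sumℚ-map-0 (x ∷ xs) = trans (cong (0ℚ +_) (sumℚ-map-0 xs)) (ℚ.+-identityˡ 0ℚ)

  sumℚ-map-+ : (g h : A → ℚ) (xs : List A) →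
               sumℚ (map (λ x → g x + h x) xs) ≡ sumℚ (map g xs) + sumℚ (map h xs)
  sumℚ-map-+ g h []       = refl
  sumℚ-map-+ g h (x ∷ xs) = begin
    (g x + h x) + sumℚ (map (λ x → g x + h x) xs)       ≡⟨ cong (g x + h x +_) (sumℚ-map-+ g h xs) ⟩
    (g x + h x) + (sumℚ (map g xs) + sumℚ (map h xs))   ≡⟨ +-interchange (g x) (h x) _ _ ⟩
    (g x + sumℚ (map g xs)) + (h x + sumℚ (map h xs))   ∎
    where open ≡-Reasoning

  sumℚ-map-*ʳ : (g : A → ℚ) (c : ℚ) (xs : List A) →
                sumℚ (map (λ x → g x * c) xs) ≡ sumℚ (map g xs) * c
  sumℚ-map-*ʳ g c []       = sym (ℚ.*-zeroˡ c)
  sumℚ-map-*ʳ g c (x ∷ xs) = begin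
    g x * c + sumℚ (map (λ x → g x * c) xs) ≡⟨ cong (g x * c +_) (sumℚ-map-*ʳ g c xs) ⟩
    g x * c + sumℚ (map g xs) * c           ≡⟨ ℚ.*-distribʳ-+ c (g x) _ ⟨
    (g x + sumℚ (map g xs)) * c             ∎
    where open ≡-Reasoning

  sumℚ-map-mono : {g h : A → ℚ} → (∀ x → g x ≤ h x) → (xs : List A) →
                  sumℚ (map g xs) ≤ sumℚ (map h xs)
  sumℚ-map-mono g≤h []       = ℚ.≤-refl
  sumℚ-map-mono g≤h (x ∷ xs) = ℚ.+-mono-≤ (g≤h x) (sumℚ-map-mono g≤h xs)

  sumℚ-map-nonNeg : {g : A → ℚ} {xs : List A} → All (λ x → 0ℚ ≤ g x) xs → 0ℚ ≤ sumℚ (map g xs)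
  sumℚ-map-nonNeg []           = ℚ.≤-refl
  sumℚ-map-nonNeg (0≤gx ∷ 0≤g) = 0≤+ 0≤gx (sumℚ-map-nonNeg 0≤g)

map-allFin-suc : ∀ {A : Set} {n} (g : Fin (ℕ.suc n) → A) →
                 map g (allFin (ℕ.suc n)) ≡ g zero ∷ map (g ∘ suc) (allFin n)
map-allFin-suc g =
  cong (g zero ∷_) (trans (map-tabulate suc g) (sym (map-tabulate (λ i → i) (g ∘ suc))))

-- partLoad j i (b , x) unfolds to indicator b (s j + x * p j) i.
indicator : ∀ {m} → Fin m → ℚ → Fin m → ℚ
indicator b x i = if does (b ≟ᶠ i) then x else 0ℚ

module _ {m} (b : Fin m) where

  indicator-nonNeg : ∀ {x} → 0ℚ ≤ x → ∀ i → 0ℚ ≤ indicator b x i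
  indicator-nonNeg 0≤x i with does (b ≟ᶠ i)
  ... | true  = 0≤x
  ... | false = ℚ.≤-refl

  indicator-mono : ∀ {x y} → x ≤ y → ∀ i → indicator b x i ≤ indicator b y i
  indicator-mono x≤y i with does (b ≟ᶠ i)
  ... | true  = x≤y
  ... | false = ℚ.≤-refl

  indicator-+ : ∀ x y i → indicator b x i + indicator b y i ≡ indicator b (x + y) i
  indicator-+ x y i with does (b ≟ᶠ i)
  ... | true  = refl
  ... | false = ℚ.+-identityˡ 0ℚ

∑-indicator : ∀ {m} (b : Fin m) x → sumℚ (map (indicator b x) (allFin m)) ≡ x
∑-indicator {ℕ.suc m} zero x = begin
  sumℚ (map (indicator zero x) (allFin (ℕ.suc m)))
    ≡⟨ cong sumℚ (map-allFin-suc {n = m} (indicator zero x)) ⟩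
  x + sumℚ (map (λ _ → 0ℚ) (allFin m))             ≡⟨ cong (x +_) (sumℚ-map-0 (allFin m)) ⟩
  x + 0ℚ                                          ≡⟨ ℚ.+-identityʳ x ⟩
  x                                               ∎
  where open ≡-Reasoning
∑-indicator {ℕ.suc m} (suc b) x = begin
  sumℚ (map (indicator (suc b) x) (allFin (ℕ.suc m)))
    ≡⟨ cong sumℚ (map-allFin-suc {n = m} (indicator (suc b) x)) ⟩
  0ℚ + sumℚ (map (indicator b x) (allFin m))          ≡⟨ ℚ.+-identityˡ _ ⟩
  sumℚ (map (indicator b x) (allFin m))               ≡⟨ ∑-indicator b x ⟩
  x                                                  ∎
  where open ≡-Reasoning

∑-indicator-diagonal : ∀ {m} (g : Fin m → ℚ) i → sumℚ (map (λ r → indicator r (g r) i) (allFin m)) ≡ g i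
∑-indicator-diagonal {ℕ.suc m} g zero = begin
  sumℚ (map (λ r → indicator r (g r) zero) (allFin (ℕ.suc m)))
    ≡⟨ cong sumℚ (map-allFin-suc {n = m} (λ r → indicator r (g r) zero)) ⟩
  g zero + sumℚ (map (λ _ → 0ℚ) (allFin m))
    ≡⟨ cong (g zero +_) (sumℚ-map-0 (allFin m)) ⟩
  g zero + 0ℚ
    ≡⟨ ℚ.+-identityʳ (g zero) ⟩
  g zero ∎
  where open ≡-Reasoning
∑-indicator-diagonal {ℕ.suc m} g (suc i) = begin
  sumℚ (map (λ r → indicator r (g r) (suc i)) (allFin (ℕ.suc m)))
    ≡⟨ cong sumℚ (map-allFin-suc {n = m} (λ r → indicator r (g r) (suc i))) ⟩
  0ℚ + sumℚ (map (λ r → indicator r (g (suc r)) i) (allFin m))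
    ≡⟨ ℚ.+-identityˡ _ ⟩
  sumℚ (map (λ r → indicator r (g (suc r)) i) (allFin m))
    ≡⟨ ∑-indicator-diagonal (g ∘ suc) i ⟩
  g (suc i) ∎
  where open ≡-Reasoning

Parts : ℕ → Set
Parts m = List (Fin m × ℚ)

IsFraction : ℚ → Set
IsFraction x = (0ℚ < x) × (x ≤ 1ℚ)

Fractions : ∀ {m} → Parts m → Set
Fractions = All (IsFraction ∘ proj₂)

ValidParts : ∀ {m} → Parts m → Set
ValidParts ps = Fractions ps × (sumℚ (map proj₂ ps) ≡ 1ℚ)

jobLoad : ∀ {m} → Job → Parts m → Fin m → ℚ
jobLoad j ps i = sumℚ (map (partLoad j i) ps)

totalSize : List Job → ℚ
totalSize = sumℚ ∘ map (λ j → s j + p j)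

totalSize-nonNeg : ∀ {J} → All PositiveJob J → 0ℚ ≤ totalSize J
totalSize-nonNeg []                 = ℚ.≤-refl
totalSize-nonNeg ((0<p , 0<s) ∷ pJ) = 0≤+ (0≤+ (ℚ.<⇒≤ 0<s) (ℚ.<⇒≤ 0<p)) (totalSize-nonNeg pJ)

module _ {m : ℕ} where

  load-∷ : ∀ j js (σ : Schedule m (j ∷ js)) i →
           load (j ∷ js) σ i ≡ jobLoad j (σ zero) i + load js (σ ∘ suc) i
  load-∷ j js σ i = cong sumℚ (map-allFin-suc (λ k → jobLoad (jobAt (j ∷ js) k) (σ k) i))

  jobLoad-nonNeg : ∀ {j} → PositiveJob j → {ps : Parts m} → Fractions ps → ∀ i → 0ℚ ≤ jobLoad j ps i
  jobLoad-nonNeg {j} (0<p , 0<s) fractions i =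
    sumℚ-map-nonNeg (All.map (λ {part} → partLoad-nonNeg {part}) fractions)
    where
    partLoad-nonNeg : ∀ {part} → IsFraction (proj₂ part) → 0ℚ ≤ partLoad j i part
    partLoad-nonNeg {b , x} (0<x , _) =
      indicator-nonNeg b (0≤+ (ℚ.<⇒≤ 0<s) (0≤* (ℚ.<⇒≤ 0<x) (ℚ.<⇒≤ 0<p))) i

  load-nonNeg : ∀ {js} → All PositiveJob js → (σ : Schedule m js) → ValidSchedule js σ →
                ∀ i → 0ℚ ≤ load js σ i
  load-nonNeg []                 σ valid i = ℚ.≤-refl
  load-nonNeg {j ∷ js} (pj ∷ pjs) σ valid i =
    subst (0ℚ ≤_) (sym (load-∷ j js σ i))
      (0≤+ (jobLoad-nonNeg pj (proj₁ (valid zero)) i) (load-nonNeg pjs (σ ∘ suc) (valid ∘ suc) i))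

  ∑-jobLoad : ∀ j (ps : Parts m) →
              sumℚ (map (jobLoad j ps) (allFin m)) ≡ sumℚ (map (λ part → s j + proj₂ part * p j) ps)
  ∑-jobLoad j []             = sumℚ-map-0 (allFin m)
  ∑-jobLoad j ((b , x) ∷ ps) = begin
    sumℚ (map (jobLoad j ((b , x) ∷ ps)) (allFin m))
      ≡⟨ sumℚ-map-+ (indicator b (s j + x * p j)) (jobLoad j ps) (allFin m) ⟩
    sumℚ (map (indicator b (s j + x * p j)) (allFin m)) + sumℚ (map (jobLoad j ps) (allFin m))
      ≡⟨ cong₂ _+_ (∑-indicator b (s j + x * p j)) (∑-jobLoad j ps) ⟩
    (s j + x * p j) + sumℚ (map (λ part → s j + proj₂ part * p j) ps)
      ∎
    where open ≡-Reasoning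

  setup+size≤partsLoad : ∀ j → 0ℚ ≤ s j → {ps : Parts m} → ValidParts ps →
                         s j + p j ≤ sumℚ (map (λ part → s j + proj₂ part * p j) ps)
  setup+size≤partsLoad j 0≤s {(b , x) ∷ ps} (_ , x+∑≡1) = begin
    s j + p j                                      ≡⟨ cong (s j +_) (ℚ.*-identityˡ (p j)) ⟨
    s j + 1ℚ * p j                                 ≡⟨ cong (λ y → s j + y * p j) x+∑≡1 ⟨
    s j + (x + sumℚ (map proj₂ ps)) * p j          ≡⟨ regroup (s j) x _ (p j) ⟩
    (s j + x * p j) + sumℚ (map proj₂ ps) * p j    ≡⟨ cong (s j + x * p j +_) (sumℚ-map-*ʳ proj₂ (p j) ps) ⟨
    (s j + x * p j) + sumℚ (map (λ part → proj₂ part * p j) ps)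
      ≤⟨ ℚ.+-monoʳ-≤ (s j + x * p j) (sumℚ-map-mono (λ part → setup≤ (proj₂ part * p j)) ps) ⟩
    (s j + x * p j) + sumℚ (map (λ part → s j + proj₂ part * p j) ps) ∎
    where
    open ℚ.≤-Reasoning
    regroup : ∀ s x y p → s + (x + y) * p ≡ (s + x * p) + y * p
    regroup = solve-∀ ringℚ
    setup≤ : ∀ y → y ≤ s j + y
    setup≤ y = subst (_≤ s j + y) (ℚ.+-identityˡ y) (ℚ.+-monoˡ-≤ y 0≤s)

  totalSize≤∑load : ∀ {J} → All PositiveJob J → (A : Schedule m J) → ValidSchedule J A →
                    totalSize J ≤ sumℚ (map (load J A) (allFin m))
  totalSize≤∑load []               A valid = ℚ.≤-reflexive (sym (sumℚ-map-0 (allFin m)))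
  totalSize≤∑load {j ∷ J} ((_ , 0<s) ∷ pJ) A valid = begin
    (s j + p j) + totalSize J
      ≤⟨ ℚ.+-mono-≤ (setup+size≤partsLoad j (ℚ.<⇒≤ 0<s) (valid zero))
                    (totalSize≤∑load pJ (A ∘ suc) (valid ∘ suc)) ⟩
    sumℚ (map (λ part → s j + proj₂ part * p j) (A zero)) + sumℚ (map (load J (A ∘ suc)) (allFin m))
      ≡⟨ cong (_+ sumℚ (map (load J (A ∘ suc)) (allFin m))) (∑-jobLoad j (A zero)) ⟨
    sumℚ (map (jobLoad j (A zero)) (allFin m)) + sumℚ (map (load J (A ∘ suc)) (allFin m))
      ≡⟨ sumℚ-map-+ (jobLoad j (A zero)) (load J (A ∘ suc)) (allFin m) ⟨
    sumℚ (map (λ i → jobLoad j (A zero) i + load J (A ∘ suc) i) (allFin m))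
      ≡⟨ cong sumℚ (map-cong (λ i → load-∷ j J A i) (allFin m)) ⟨
    sumℚ (map (load (j ∷ J) A) (allFin m)) ∎
    where open ℚ.≤-Reasoning

  load-∷ʳ : ∀ j js S σ τ i a → head σ ≡ head τ → load js (tail σ) i ≡ a + load S (tail τ) i →
            load (j ∷ js) σ i ≡ a + load (j ∷ S) τ i
  load-∷ʳ j js S σ τ i a σ₀≡τ₀ split = begin
    load (j ∷ js) σ i                          ≡⟨ load-∷ j js σ i ⟩
    jobLoad j (head σ) i + load js (tail σ) i  ≡⟨ cong₂ (λ x y → jobLoad j x i + y) σ₀≡τ₀ split ⟩
    jobLoad j (head τ) i + (a + load S (tail τ) i) ≡⟨ x∙yz≈y∙xz (jobLoad j (head τ) i) a _ ⟩
    a + (jobLoad j (head τ) i + load S (tail τ) i) ≡⟨ cong (a +_) (load-∷ j S τ i) ⟨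
    a + load (j ∷ S) τ i                       ∎
    where open ≡-Reasoning

  load-∷ˡ : ∀ j js R σ τ i b → head σ ≡ head τ → load js (tail σ) i ≡ load R (tail τ) i + b →
            load (j ∷ js) σ i ≡ load (j ∷ R) τ i + b
  load-∷ˡ j js R σ τ i b σ₀≡τ₀ split = begin
    load (j ∷ js) σ i                          ≡⟨ load-∷ j js σ i ⟩
    jobLoad j (head σ) i + load js (tail σ) i  ≡⟨ cong₂ (λ x y → jobLoad j x i + y) σ₀≡τ₀ split ⟩
    jobLoad j (head τ) i + (load R (tail τ) i + b) ≡⟨ ℚ.+-assoc (jobLoad j (head τ) i) _ b ⟨
    (jobLoad j (head τ) i + load R (tail τ) i) + b ≡⟨ cong (_+ b) (load-∷ j R τ i) ⟨
    load (j ∷ R) τ i + b                       ∎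
    where open ≡-Reasoning

  ∷-All : ∀ {n} {Q : Parts m → Set} {x} {τ : Fin n → Parts m} →
          Q x → (∀ k → Q (τ k)) → ∀ k → Q ((x Vector.∷ τ) k)
  ∷-All qx qτ zero    = qx
  ∷-All qx qτ (suc k) = qτ k

module Filtered {m : ℕ} {P : Job → Set} (P? : Decidable P) where

  merge : ∀ js → Schedule m (filter (∁? P?) js) → Schedule m (filter P? js) → Schedule m js
  merge []       σ₁ σ₂ = σ₁
  merge (j ∷ js) σ₁ σ₂ with P? j
  ... | yes _ = head σ₂ Vector.∷ merge js σ₁ (tail σ₂)
  ... | no  _ = head σ₁ Vector.∷ merge js (tail σ₁) σ₂

  selected : ∀ js → Schedule m js → Schedule m (filter P? js)
  selected []       σ = σ
  selected (j ∷ js) σ with P? j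
  ... | yes _ = head σ Vector.∷ selected js (tail σ)
  ... | no  _ = selected js (tail σ)

  rejected : ∀ js → Schedule m js → Schedule m (filter (∁? P?) js)
  rejected []       σ = σ
  rejected (j ∷ js) σ with P? j
  ... | yes _ = rejected js (tail σ)
  ... | no  _ = head σ Vector.∷ rejected js (tail σ)

  module _ {Q : Parts m → Set} where

    merge-All : ∀ js {σ₁ σ₂} → (∀ k → Q (σ₁ k)) → (∀ k → Q (σ₂ k)) → ∀ k → Q (merge js σ₁ σ₂ k)
    merge-All []       q₁ q₂ = q₁
    merge-All (j ∷ js) q₁ q₂ with P? j
    ... | yes _ = ∷-All {Q = Q} (q₂ zero) (merge-All js q₁ (q₂ ∘ suc))
    ... | no  _ = ∷-All {Q = Q} (q₁ zero) (merge-All js (q₁ ∘ suc) q₂)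

    selected-All : ∀ js {σ} → (∀ k → Q (σ k)) → ∀ k → Q (selected js σ k)
    selected-All []       q = q
    selected-All (j ∷ js) q with P? j
    ... | yes _ = ∷-All {Q = Q} (q zero) (selected-All js (q ∘ suc))
    ... | no  _ = selected-All js (q ∘ suc)

    rejected-All : ∀ js {σ} → (∀ k → Q (σ k)) → ∀ k → Q (rejected js σ k)
    rejected-All []       q = q
    rejected-All (j ∷ js) q with P? j
    ... | yes _ = rejected-All js (q ∘ suc)
    ... | no  _ = ∷-All {Q = Q} (q zero) (rejected-All js (q ∘ suc))

  load-merge : ∀ js σ₁ σ₂ i →
               load js (merge js σ₁ σ₂) i ≡ load (filter (∁? P?) js) σ₁ i + load (filter P? js) σ₂ i
  load-merge []       σ₁ σ₂ i = refl
  load-merge (j ∷ js) σ₁ σ₂ i with P? j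
  ... | yes _ = load-∷ʳ j js (filter P? js) (head σ₂ Vector.∷ merge js σ₁ (tail σ₂)) σ₂ i
                  (load (filter (∁? P?) js) σ₁ i) refl (load-merge js σ₁ (tail σ₂) i)
  ... | no  _ = load-∷ˡ j js (filter (∁? P?) js) (head σ₁ Vector.∷ merge js (tail σ₁) σ₂) σ₁ i
                  (load (filter P? js) σ₂ i) refl (load-merge js (tail σ₁) σ₂ i)

  load-split : ∀ js σ i →
               load js σ i ≡ load (filter (∁? P?) js) (rejected js σ) i + load (filter P? js) (selected js σ) i
  load-split []       σ i = sym (ℚ.+-identityˡ 0ℚ)
  load-split (j ∷ js) σ i with P? j
  ... | yes _ = load-∷ʳ j js (filter P? js) σ (head σ Vector.∷ selected js (tail σ)) i
                  (load (filter (∁? P?) js) (rejected js (tail σ)) i) refl (load-split js (tail σ) i)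
  ... | no  _ = load-∷ˡ j js (filter (∁? P?) js) σ (head σ Vector.∷ rejected js (tail σ)) i
                  (load (filter P? js) (selected js (tail σ)) i) refl (load-split js (tail σ) i)

module Packing {m : ℕ} (f : Fin m → ℚ) (δ : ℚ) (f≥0 : ∀ i → 0ℚ ≤ f i) (δ≥0 : 0ℚ ≤ δ) where

  -- The packer is filling machine current, which may still take room out of its free space f and
  -- slack out of its extra allowance δ; the machines in fresh are untouched.
  record State : Set where
    constructor state
    field
      current     : Fin m
      room slack  : ℚ
      fresh       : List (Fin m)
      room≥0      : 0ℚ ≤ room
      slack≥0     : 0ℚ ≤ slack
  open State

  initial : Fin m → List (Fin m) → State
  initial r R = state r (f r) δ R (f≥0 r) δ≥0

  capacity : State → ℚ
  capacity st = room st + sumℚ (map f (fresh st))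

  allowance : State → Fin m → ℚ
  allowance st i = indicator (current st) (room st + slack st) i
                 + sumℚ (map (λ r → indicator r (f r + δ) i) (fresh st))

  allowance-nonNeg : ∀ st i → 0ℚ ≤ allowance st i
  allowance-nonNeg st i =
    0≤+ (indicator-nonNeg (current st) (0≤+ (room≥0 st) (slack≥0 st)) i)
        (sumℚ-map-nonNeg (All.universal (λ r → indicator-nonNeg r (0≤+ (f≥0 r) δ≥0) i) (fresh st)))

  -- A request places the fraction t of job j, of whose setup π has already been paid;
  -- demand is what it costs of the free space.
  demand : Job → ℚ → ℚ → ℚ
  demand j t π = t * p j + s j - π

  record Placement (j : Job) (t π : ℚ) (st : State) : Set where
    field
      parts            : Parts m
      fractions        : Fractions parts
      parts-sum        : sumℚ (map proj₂ parts) ≡ t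
      next             : State
      capacity-next    : capacity next ≡ capacity st - demand j t π
      within-allowance : ∀ i → jobLoad j parts i + allowance next i ≤ allowance st i

  Placeable : Job → State → Set
  Placeable j st = ∀ t π → π ≤ slack st → IsFraction t → demand j t π ≤ capacity st → Placement j t π st

  placeHere : ∀ {j t π b c a R c≥0 a≥0} → π ≤ a → IsFraction t → demand j t π ≤ c →
              Placement j t π (state b c a R c≥0 a≥0)
  placeHere {j} {t} {π} {b} {c} {a} {R} π≤a frac d≤c = record
    { parts            = (b , t) ∷ []
    ; fractions        = frac ∷ []
    ; parts-sum        = ℚ.+-identityʳ t
    ; next             = state b (c - d) (a - π) R (p≤q⇒0≤q-p d≤c) (p≤q⇒0≤q-p π≤a)
    ; capacity-next    = [c-d]+X≡[c+X]-d c d (sumℚ (map f R))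
    ; within-allowance = λ i → ℚ.≤-reflexive (allowance-next i)
    }
    where
    open ≡-Reasoning
    d = demand j t π
    [c-d]+X≡[c+X]-d : ∀ c d X → (c - d) + X ≡ (c + X) - d
    [c-d]+X≡[c+X]-d = solve-∀ ringℚ
    used-up : ∀ s t p c a π → (s + t * p) + ((c - (t * p + s - π)) + (a - π)) ≡ c + a
    used-up = solve-∀ ringℚ
    allowance-next : ∀ i {Y} →
      (indicator b (s j + t * p j) i + 0ℚ) + (indicator b ((c - d) + (a - π)) i + Y) ≡ indicator b (c + a) i + Y
    allowance-next i {Y} = begin
      (used + 0ℚ) + (left + Y)  ≡⟨ cong (_+ (left + Y)) (ℚ.+-identityʳ used) ⟩
      used + (left + Y)         ≡⟨ ℚ.+-assoc used left Y ⟨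
      (used + left) + Y         ≡⟨ cong (_+ Y) (indicator-+ b _ _ i) ⟩
      indicator b ((s j + t * p j) + ((c - d) + (a - π))) i + Y
        ≡⟨ cong (λ x → indicator b x i + Y) (used-up (s j) t (p j) c a π) ⟩
      indicator b (c + a) i + Y ∎
      where
      used = indicator b (s j + t * p j) i
      left = indicator b ((c - d) + (a - π)) i

  capacity-handover : ∀ {j t π t′ π′ c r R} (O : Placement j t′ π′ (initial r R)) →
                      demand j t′ π′ ≡ demand j t π - c →
                      capacity (Placement.next O) ≡ (c + capacity (initial r R)) - demand j t π
  capacity-handover {j} {t} {π} {t′} {π′} {c} {r} {R} O demand-rest = begin
    capacity (Placement.next O)                 ≡⟨ Placement.capacity-next O ⟩
    capacity (initial r R) - demand j t′ π′     ≡⟨ cong (λ d → capacity (initial r R) - d) demand-rest ⟩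
    capacity (initial r R) - (demand j t π - c) ≡⟨ X-[d-c]≡[c+X]-d c (demand j t π) _ ⟩
    (c + capacity (initial r R)) - demand j t π ∎
    where
    open ≡-Reasoning
    X-[d-c]≡[c+X]-d : ∀ c d X → X - (d - c) ≡ (c + X) - d
    X-[d-c]≡[c+X]-d = solve-∀ ringℚ

  -- No positive fraction fits into room that does not even cover the unpaid setup: the room is
  -- spent on the setup and the request moves on.
  skipTo : ∀ {j t π b c a r R c≥0 a≥0} → s j ≤ δ → IsFraction t → c ≤ s j - π →
           demand j t π ≤ c + capacity (initial r R) → Placeable j (initial r R) →
           Placement j t π (state b c a (r ∷ R) c≥0 a≥0)
  skipTo {j} {t} {π} {b} {c} {a} {r} {R} {c≥0} {a≥0} s≤δ frac c≤s-π d≤cap place = record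
    { parts            = O.parts
    ; fractions        = O.fractions
    ; parts-sum        = O.parts-sum
    ; next             = O.next
    ; capacity-next    = capacity-handover {t = t} {π = π} {c = c} O demand-rest
    ; within-allowance = λ i →
        ℚ.≤-trans (O.within-allowance i) (p≤q+p (indicator-nonNeg b (0≤+ c≥0 a≥0) i))
    }
    where
    shift : ∀ t p s π c → t * p + s - (π + c) ≡ (t * p + s - π) - c
    shift = solve-∀ ringℚ
    demand-rest : demand j t (π + c) ≡ demand j t π - c
    demand-rest = shift t (p j) (s j) π c
    reorder : ∀ s π c → s - (π + c) ≡ (s - π) - c
    reorder = solve-∀ ringℚ
    π+c≤δ : π + c ≤ δ
    π+c≤δ = ℚ.≤-trans (≤-byDifference (reorder (s j) π c) (p≤q⇒0≤q-p c≤s-π)) s≤δ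
    O : Placement j t (π + c) (initial r R)
    O = place t (π + c) π+c≤δ frac
          (subst (_≤ capacity (initial r R)) (sym demand-rest) (p≤q+r⇒p-q≤r d≤cap))
    module O = Placement O

  fillingFraction : ∀ {j t π c} → 0ℚ < p j → s j - π < c → c < demand j t π →
                    Σ ℚ λ u → (0ℚ < u) × (u < t) × (s j + u * p j ≡ c + π)
                              × (demand j (t - u) (s j) ≡ demand j t π - c)
  fillingFraction {j} {t} {π} {c} 0<p s-π<c c<d = u , 0<u , u<t , filled , demand-rest
    where
    open ≡-Reasoning
    x = c - (s j - π)
    tp-x≡d-c : ∀ t p s π c → t * p - (c - (s - π)) ≡ (t * p + s - π) - c
    tp-x≡d-c = solve-∀ ringℚ
    x<tp : x < t * p j
    x<tp = <-byDifference (tp-x≡d-c t (p j) (s j) π c) (p<q⇒0<q-p c<d)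
    fraction = fractionOf 0<p (p<q⇒0<q-p s-π<c) x<tp
    u = proj₁ fraction
    0<u = proj₁ (proj₂ fraction)
    u<t = proj₁ (proj₂ (proj₂ fraction))
    up≡x = proj₂ (proj₂ (proj₂ fraction))
    s+x≡c+π : ∀ s π c → s + (c - (s - π)) ≡ c + π
    s+x≡c+π = solve-∀ ringℚ
    filled : s j + u * p j ≡ c + π
    filled = trans (cong (s j +_) up≡x) (s+x≡c+π (s j) π c)
    distrib : ∀ t u p s → (t - u) * p + s - s ≡ t * p - u * p
    distrib = solve-∀ ringℚ
    demand-rest : demand j (t - u) (s j) ≡ demand j t π - c
    demand-rest = begin
      (t - u) * p j + s j - s j  ≡⟨ distrib t u (p j) (s j) ⟩
      t * p j - u * p j          ≡⟨ cong (λ y → t * p j - y) up≡x ⟩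
      t * p j - x                ≡⟨ tp-x≡d-c t (p j) (s j) π c ⟩
      demand j t π - c           ∎

  -- The remainder of the split job restarts on the next machine and pays its whole setup out of
  -- that machine's slack.
  splitOver : ∀ {j t π b c a r R c≥0 a≥0} → 0ℚ < p j → s j ≤ δ → π ≤ a → IsFraction t →
              s j - π < c → c < demand j t π → demand j t π ≤ c + capacity (initial r R) →
              Placeable j (initial r R) → Placement j t π (state b c a (r ∷ R) c≥0 a≥0)
  splitOver {j} {t} {π} {b} {c} {a} {r} {R} 0<p s≤δ π≤a (_ , t≤1) s-π<c c<d d≤cap place = record
    { parts            = (b , u) ∷ O.parts
    ; fractions        = (0<u , ℚ.<⇒≤ (ℚ.<-≤-trans u<t t≤1)) ∷ O.fractions
    ; parts-sum        = trans (cong (u +_) O.parts-sum) (u+[t-u]≡t u t)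
    ; next             = O.next
    ; capacity-next    = capacity-handover {t = t} {π = π} {c = c} O demand-rest
    ; within-allowance = λ i → begin
        jobLoad j ((b , u) ∷ O.parts) i + allowance O.next i
          ≡⟨ ℚ.+-assoc (indicator b (s j + u * p j) i) _ _ ⟩
        indicator b (s j + u * p j) i + (jobLoad j O.parts i + allowance O.next i)
          ≤⟨ ℚ.+-mono-≤ (indicator-mono b first-part≤ i) (O.within-allowance i) ⟩
        indicator b (c + a) i + allowance (initial r R) i ∎
    }
    where
    open ℚ.≤-Reasoning
    split = fillingFraction {t = t} 0<p s-π<c c<d
    u = proj₁ split
    0<u = proj₁ (proj₂ split)
    u<t = proj₁ (proj₂ (proj₂ split))
    filled = proj₁ (proj₂ (proj₂ (proj₂ split)))
    demand-rest = proj₂ (proj₂ (proj₂ (proj₂ split)))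
    u+[t-u]≡t : ∀ u t → u + (t - u) ≡ t
    u+[t-u]≡t = solve-∀ ringℚ
    first-part≤ : s j + u * p j ≤ c + a
    first-part≤ = subst (_≤ c + a) (sym filled) (ℚ.+-monoʳ-≤ c π≤a)
    O : Placement j (t - u) (s j) (initial r R)
    O = place (t - u) (s j) s≤δ (p<q⇒0<q-p u<t , ℚ.≤-trans (p-q≤p (ℚ.<⇒≤ 0<u)) t≤1)
          (subst (_≤ capacity (initial r R)) (sym demand-rest) (p≤q+r⇒p-q≤r d≤cap))
    module O = Placement O

  placeOn : ∀ {j} → 0ℚ < p j → s j ≤ δ → ∀ R {b c a c≥0 a≥0} → Placeable j (state b c a R c≥0 a≥0)
  placeOn {j} 0<p s≤δ R {c = c} t π π≤a frac d≤cap with demand j t π ℚ.≤? c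
  ... | yes d≤c = placeHere π≤a frac d≤c
  placeOn {j} 0<p s≤δ [] {c = c} t π π≤a frac d≤cap | no d≰c =
    ⊥-elim (d≰c (subst (demand j t π ≤_) (ℚ.+-identityʳ c) d≤cap))
  placeOn {j} 0<p s≤δ (r ∷ R) {c = c} t π π≤a frac d≤cap | no d≰c with s j - π ℚ.<? c
  ... | yes s-π<c = splitOver 0<p s≤δ π≤a frac s-π<c (ℚ.≰⇒> d≰c) d≤cap (placeOn 0<p s≤δ R)
  ... | no  s-π≮c = skipTo s≤δ frac (ℚ.≮⇒≥ s-π≮c) d≤cap (placeOn 0<p s≤δ R)

  packFrom : ∀ {J} → All PositiveJob J → All (λ j → s j ≤ δ) J → ∀ st → totalSize J ≤ capacity st →
             Σ (Schedule m J) λ A → ValidSchedule J A × (∀ i → load J A i ≤ allowance st i)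
  packFrom []                      []           st _        = (λ ()) , (λ ()) , allowance-nonNeg st
  packFrom {j ∷ J} ((0<p , _) ∷ pJ) (s≤δ ∷ sJ) st size≤cap =
    O.parts Vector.∷ A , ∷-All {Q = ValidParts} (O.fractions , O.parts-sum) validA , bound
    where
    whole : ∀ p s → 1ℚ * p + s - 0ℚ ≡ s + p
    whole = solve-∀ ringℚ
    whole≡size : demand j 1ℚ 0ℚ ≡ s j + p j
    whole≡size = whole (p j) (s j)
    O : Placement j 1ℚ 0ℚ st
    O = placeOn 0<p s≤δ (fresh st) 1ℚ 0ℚ (slack≥0 st) (ℚ.positive⁻¹ 1ℚ , ℚ.≤-refl)
          (subst (_≤ capacity st) (sym whole≡size)
            (ℚ.≤-trans (p≤p+q (totalSize-nonNeg pJ)) size≤cap))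
    module O = Placement O
    rest = packFrom pJ sJ O.next
             (subst (totalSize J ≤_) (sym (trans O.capacity-next (cong (λ d → capacity st - d) whole≡size)))
               (p+q≤r⇒q≤r-p size≤cap))
    A = proj₁ rest
    validA = proj₁ (proj₂ rest)
    bound : ∀ i → load (j ∷ J) (O.parts Vector.∷ A) i ≤ allowance st i
    bound i = begin
      load (j ∷ J) (O.parts Vector.∷ A) i       ≡⟨ load-∷ j J (O.parts Vector.∷ A) i ⟩
      jobLoad j O.parts i + load J A i         ≤⟨ ℚ.+-monoʳ-≤ (jobLoad j O.parts i) (proj₂ (proj₂ rest) i) ⟩
      jobLoad j O.parts i + allowance O.next i ≤⟨ O.within-allowance i ⟩
      allowance st i                           ∎
      where open ℚ.≤-Reasoning

pack : ∀ {m} (f : Fin m → ℚ) (δ : ℚ) → (∀ i → 0ℚ ≤ f i) → 0ℚ ≤ δ →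
       ∀ {J} → All PositiveJob J → All (λ j → s j ≤ δ) J → totalSize J ≤ sumℚ (map f (allFin m)) →
       Σ (Schedule m J) λ A → ValidSchedule J A × (∀ i → load J A i ≤ f i + δ)
pack {ℕ.zero} f δ f≥0 δ≥0 [] [] _ = (λ ()) , (λ ()) , (λ ())
pack {ℕ.zero} f δ f≥0 δ≥0 {j ∷ J} ((0<p , 0<s) ∷ pJ) _ size≤0 =
  ⊥-elim (ℚ.<-irrefl refl (ℚ.<-≤-trans 0<size size≤0))
  where
  0<size : 0ℚ < totalSize (j ∷ J)
  0<size = ℚ.+-mono-<-≤ (ℚ.+-mono-< 0<s 0<p) (totalSize-nonNeg pJ)
pack {ℕ.suc m} f δ f≥0 δ≥0 {J} pJ sJ size≤∑f =
  A , validA , λ i → subst (load J A i ≤_) (∑-indicator-diagonal (λ r → f r + δ) i) (boundA i)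
  where
  open Packing f δ f≥0 δ≥0
  packed = packFrom pJ sJ (initial zero (tabulate suc)) size≤∑f
  A = proj₁ packed
  validA = proj₁ (proj₂ packed)
  boundA = proj₂ (proj₂ packed)

module _ {m : ℕ} {P : Job → Set} (P? : Decidable P) where
  open Filtered {m} P?

  removeJobs : ∀ {js} → All PositiveJob js → ∀ σ T → ValidSchedule js σ → MakespanAtMost js σ T →
               IsTLSchedule (filter (∁? P?) js) (rejected js σ) T (totalSize (filter P? js))
  removeJobs {js} pos σ T valid makespan = rejected-All {Q = ValidParts} js valid , makespan₁ , free
    where
    R = filter (∁? P?) js
    S = filter P? js
    posS = filter⁺ P? pos
    validS = selected-All {Q = ValidParts} js valid
    loads≤T : ∀ i → load R (rejected js σ) i + load S (selected js σ) i ≤ T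
    loads≤T i = subst (_≤ T) (load-split js σ i) (makespan i)
    makespan₁ : MakespanAtMost R (rejected js σ) T
    makespan₁ i = ℚ.≤-trans (p≤p+q (load-nonNeg posS (selected js σ) validS i)) (loads≤T i)
    free : totalSize S ≤ freeSpace R (rejected js σ) T
    free = begin
      totalSize S                                      ≤⟨ totalSize≤∑load posS (selected js σ) validS ⟩
      sumℚ (map (load S (selected js σ)) (allFin m))   ≤⟨ sumℚ-map-mono (λ i → p+q≤r⇒q≤r-p (loads≤T i)) (allFin m) ⟩
      freeSpace R (rejected js σ) T                    ∎
      where open ℚ.≤-Reasoning

  reinsertJobs : ∀ {js δ T'} → 0ℚ ≤ δ → All PositiveJob js → (∀ {j} → P j → s j ≤ δ) →
                 ∀ σ₁ → IsTLSchedule (filter (∁? P?) js) σ₁ T' (totalSize (filter P? js)) →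
                 Σ (Schedule m js) λ σ → ValidSchedule js σ × MakespanAtMost js σ (T' + δ)
  reinsertJobs {js} {δ} {T'} 0≤δ pos P⇒s≤δ σ₁ (valid₁ , makespan₁ , free) =
    merge js σ₁ A , merge-All {Q = ValidParts} js valid₁ validA , makespan
    where
    R = filter (∁? P?) js
    S = filter P? js
    packed = pack (λ i → T' - load R σ₁ i) δ (λ i → p≤q⇒0≤q-p (makespan₁ i)) 0≤δ
                  (filter⁺ P? pos) (All.map P⇒s≤δ (all-filter P? js)) free
    A = proj₁ packed
    validA = proj₁ (proj₂ packed)
    a+[[T-a]+δ]≡T+δ : ∀ a T δ → a + ((T - a) + δ) ≡ T + δ
    a+[[T-a]+δ]≡T+δ = solve-∀ ringℚ
    makespan : MakespanAtMost js (merge js σ₁ A) (T' + δ)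
    makespan i = begin
      load js (merge js σ₁ A) i                 ≡⟨ load-merge js σ₁ A i ⟩
      load R σ₁ i + load S A i                  ≤⟨ ℚ.+-monoʳ-≤ (load R σ₁ i) (proj₂ (proj₂ packed) i) ⟩
      load R σ₁ i + ((T' - load R σ₁ i) + δ)    ≡⟨ a+[[T-a]+δ]≡T+δ (load R σ₁ i) T' δ ⟩
      T' + δ                                    ∎
      where open ℚ.≤-Reasoning

lemma11 : (m : ℕ) (js : List Job) → All PositiveJob js →
    (ε T : ℚ) → 0ℚ < ε → ε < 1ℚ → 0ℚ < T → All (λ j → s j ≤ T) js →
    (((σ : Schedule m js) → ValidSchedule js σ → MakespanAtMost js σ T →
       Σ (Schedule m (removeSmall ε T js))
         (λ σ₁ → IsTLSchedule (removeSmall ε T js) σ₁ T (bigL ε T js)))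
    × ((T' : ℚ) → 0ℚ < T' → (σ₁ : Schedule m (removeSmall ε T js)) →
       IsTLSchedule (removeSmall ε T js) σ₁ T' (bigL ε T js) →
       Σ (Schedule m js)
         (λ σ → ValidSchedule js σ × MakespanAtMost js σ (T' + ε * T))))
lemma11 m js pos ε T 0<ε _ 0<T _ =
    (λ σ valid makespan → rejected js σ , removeJobs small? pos σ T valid makespan)
  , (λ T' _ → reinsertJobs small? (0≤* (ℚ.<⇒≤ 0<ε) (ℚ.<⇒≤ 0<T)) pos ℚ.<⇒≤)
  where
  small? : Decidable (λ j → s j < ε * T)
  small? j = s j ℚ.<? ε * T
  open Filtered {m} small?
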